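{- Let $G$ be a balanced bipartite graph with bipartition $(X,Y)$ and let $S\subseteq X$. Let $P=x_1y_1x_2y_2\cdots x_py_p$ be a path of $G$ with $x_i\in X$, $y_i\in Y$, $p\ne 1$, and $x_1,x_p\in S$. Suppose that $G[V(P)]$ contains neither a cycle containing at least two vertices of $S$, nor a path $P'$ of even order with $|P'|<|P|$ and $S\cap V(P')=S\cap V(P)$. Then $d_P(x_1)=1$, $d_P(x_i)=2$ for each $x_i\in (S\cap V(P))\setminus\{x_1\}$, and $d_P(y_p)\le 2$.
   Context: For a vertex $v$, $d_P(v)=|N_G(v)\cap V(P)|$. $|P|$ denotes the number of vertices of $P$. -}

module Defs where

open import Data.Nat using (ℕ; suc; _≤_)
open import Data.Fin using (Fin)
open import Data.Bool using (Bool; T)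
open import Data.Sum using (_⊎_; inj₁; inj₂)
open import Data.Empty using (⊥)
open import Data.Product using (_×_)
open import Data.List using (List; []; _∷_; _++_; [_]; length; filterᵇ; concatMap)
open import Data.List.Relation.Unary.Linked using (Linked)
open import Data.List.Relation.Unary.Unique.Propositional using (Unique)
open import Data.Vec.Functional using (toList)

-- X = Fin n, Y = Fin n; edges only go between X and Y,
-- given by a Boolean bi-adjacency relation  E x y  (x ∈ X, y ∈ Y).
BipGraph : ℕ → Set
BipGraph n = Fin n → Fin n → Bool

-- Vertices of G: inj₁ x for x ∈ X, inj₂ y for y ∈ Y.
Vtx : ℕ → Set
Vtx n = Fin n ⊎ Fin n

adjᵇ : ∀ {n} → BipGraph n → Vtx n → Vtx n → Bool
adjᵇ E (inj₁ x) (inj₂ y) = E x y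
adjᵇ E (inj₂ y) (inj₁ x) = E x y
adjᵇ E (inj₁ _) (inj₁ _) = Data.Bool.false
adjᵇ E (inj₂ _) (inj₂ _) = Data.Bool.false

Adj : ∀ {n} → BipGraph n → Vtx n → Vtx n → Set
Adj E u v = T (adjᵇ E u v)

IsPath : ∀ {n} → BipGraph n → List (Vtx n) → Set
IsPath E vs = Unique vs × Linked (Adj E) vs

IsCycle : ∀ {n} → BipGraph n → List (Vtx n) → Set
IsCycle E [] = ⊥
IsCycle E (v ∷ vs) = Unique (v ∷ vs) × (3 ≤ length (v ∷ vs)) × Linked (Adj E) ((v ∷ vs) ++ [ v ])

alternating : ∀ {n p} → (Fin p → Fin n) → (Fin p → Fin n) → List (Vtx n)
alternating {p = p} x y = concatMap (λ i → inj₁ (x i) ∷ inj₂ (y i) ∷ []) (toList {n = p} (λ i → i))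

deg : ∀ {n} → BipGraph n → Vtx n → List (Vtx n) → ℕ
deg E v P = length (filterᵇ (adjᵇ E v) P)

-- Let x_i ∈ S and let x_i y_j be a chord of P with j ∉ {i − 1, i}. The segment of P
-- between x_i and y_j has an even, nonzero number of interior vertices. If one of them lies in S,
-- the segment closed by the chord is a cycle through two vertices of S. Otherwise, cutting out the
-- interior and crossing the chord leaves a shorter path of even order with the same S-vertices.
-- Hence the only neighbours of x_i on P are its path neighbours, which gives d_P(x_1) = 1 and
-- d_P(x_i) = 2. For y_p the same argument excludes chords x_j y_p with j ≤ p − 2; since x_p ∈ S
-- must be kept, the shorter path is now x_1 y_1 … x_j y_p x_p y_{p−1}.

module Submission where

open import Defs
open import Data.Nat using (ℕ; suc; _≤_; _<_; _*_)
open import Data.Fin using (Fin; zero; fromℕ)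
open import Data.Bool using (Bool; T)
open import Data.Sum using (inj₁; inj₂)
open import Data.Product using (_×_; ∃; ∃₂)
open import Data.List using (List; length)
open import Data.List.Membership.Propositional using (_∈_)
open import Data.List.Relation.Unary.All using (All)
open import Relation.Nullary using (¬_)
open import Relation.Binary.PropositionalEquality using (_≡_; _≢_)
open import Function.Bundles using (_⇔_)

open import Data.Nat using (zero; _+_; _∸_; z≤n; s≤s; z<s)
open import Data.Nat.Properties
open import Data.Nat.Tactic.RingSolver using (solve-∀)
open import Data.Fin using (suc; toℕ)
open import Data.Fin.Properties using (toℕ-fromℕ; toℕ<n)
open import Data.Bool using (true; false; T?)
open import Data.Empty using (⊥; ⊥-elim)
open import Data.Sum using (_⊎_)
open import Data.Product using (_,_; proj₁; proj₂)
open import Data.List using ([]; _∷_; _++_; [_]; map; concat; concatMap; filterᵇ; tabulate)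
open import Data.List.Properties
  using (length-map; length-++; map-++; ++-identityʳ; filter-++; filter-none; filter-accept; length-filter;
         map-tabulate; tabulate-cong)
open import Data.List.Membership.Propositional using (find; lose)
open import Data.List.Membership.Propositional.Properties using (∈-map⁺; ∈-map⁻; ∈-++⁺ˡ; ∈-++⁺ʳ; ∈-++⁻)
open import Data.List.Relation.Unary.Any using (here; there; any?)
import Data.List.Relation.Unary.All as All
open import Data.List.Relation.Unary.All.Properties using () renaming (map⁺ to All-map⁺)
open import Data.List.Relation.Unary.AllPairs using ([]; _∷_)
open import Data.List.Relation.Unary.Unique.Propositional using (Unique)
open import Data.List.Relation.Unary.Unique.Propositional.Properties using (++⁺)
open import Data.List.Relation.Unary.Linked using (Linked; [-]; _∷_)
import Data.List.Relation.Unary.Linked.Properties as Linked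
open import Data.List.Relation.Binary.Permutation.Propositional using (_↭_; ↭-refl; ↭-sym; ↭⇒↭ₛ)
open import Data.List.Relation.Binary.Permutation.Propositional.Properties using (↭-length; ∈-resp-↭; ↭-reverse)
import Data.List.Relation.Binary.Permutation.Setoid.Properties as Permutationₛ
open import Relation.Nullary using (yes; no)
open import Relation.Binary.PropositionalEquality
  using (refl; sym; trans; cong; cong₂; subst; subst₂; setoid; module ≡-Reasoning)
open import Function using (_∘_; _on_; case_of_)
open import Function.Bundles using (mk⇔)

range : ℕ → ℕ → List ℕ
range a zero    = []
range a (suc l) = a ∷ range (suc a) l

length-range : ∀ a l → length (range a l) ≡ l
length-range a zero    = refl
length-range a (suc l) = cong suc (length-range (suc a) l)

∈-range⁺ : ∀ {a l k} → a ≤ k → k < a + l → k ∈ range a l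
∈-range⁺ {a} {zero} {k} a≤k k<a+0 = ⊥-elim (<⇒≱ (subst (k <_) (+-identityʳ a) k<a+0) a≤k)
∈-range⁺ {a} {suc l} {k} a≤k k<a+1+l with a ≟ k
... | yes refl = here refl
... | no  a≢k  = there (∈-range⁺ (≤∧≢⇒< a≤k a≢k) (subst (k <_) (+-suc a l) k<a+1+l))

∈-range⁻ : ∀ {a l k} → k ∈ range a l → a ≤ k × k < a + l
∈-range⁻ {a} {suc l} (here refl) = ≤-refl , m<m+n a z<s
∈-range⁻ {a} {suc l} {k} (there k∈) =
  let a<k , k<a+1+l = ∈-range⁻ k∈ in <⇒≤ a<k , subst (k <_) (sym (+-suc a l)) k<a+1+l

range-++ : ∀ a l₁ l₂ → range a (l₁ + l₂) ≡ range a l₁ ++ range (a + l₁) l₂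
range-++ a zero     l₂ rewrite +-identityʳ a = refl
range-++ a (suc l₁) l₂ rewrite +-suc a l₁ = cong (a ∷_) (range-++ (suc a) l₁ l₂)

map-range-suc : ∀ {A : Set} (f : ℕ → A) a l → map f (range (suc a) l) ≡ map (f ∘ suc) (range a l)
map-range-suc f a zero    = refl
map-range-suc f a (suc l) = cong (f (suc a) ∷_) (map-range-suc f (suc a) l)

Unique-range : ∀ a l → Unique (range a l)
Unique-range a zero    = []
Unique-range a (suc l) =
  All.tabulate (λ k∈ a≡k → <⇒≢ (proj₁ (∈-range⁻ k∈)) a≡k) ∷ Unique-range (suc a) l

range-linked⁺ : ∀ {R : ℕ → ℕ → Set} a l {ms} → (∀ {k} → k < a + l → R k (suc k)) →
                Linked R (a + l ∷ ms) → Linked R (range a (suc l) ++ ms)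
range-linked⁺ a zero    steps last rewrite +-identityʳ a = last
range-linked⁺ {R} a (suc l) {ms} steps last =
  steps (m<m+n a z<s) ∷
  range-linked⁺ (suc a) l (λ {k} k< → steps (subst (k <_) (sym (+-suc a l)) k<))
                (subst (λ z → Linked R (z ∷ ms)) (+-suc a l) last)

Linked-range⇒step : ∀ {R : ℕ → ℕ → Set} a l → Linked R (range a l) →
                    ∀ {k} → a ≤ k → suc k < a + l → R k (suc k)
Linked-range⇒step a zero       _ {k} a≤k k<a+0 =
  ⊥-elim (<⇒≱ (<-trans (n<1+n k) (subst (suc k <_) (+-identityʳ a) k<a+0)) a≤k)
Linked-range⇒step a (suc zero) _ {k} a≤k k<a+1 =
  ⊥-elim (<⇒≱ (≤-pred (subst (suc k <_) (+-comm a 1) k<a+1)) a≤k)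
Linked-range⇒step a (suc (suc l)) (r ∷ rs) {k} a≤k k<a+2+l with a ≟ k
... | yes refl = r
... | no  a≢k  =
  Linked-range⇒step (suc a) (suc l) rs (≤∧≢⇒< a≤k a≢k) (subst (suc k <_) (+-suc a (suc l)) k<a+2+l)

unique-map⇒injectiveOn : ∀ {A B : Set} (f : A → B) {xs} → Unique (map f xs) →
                         ∀ {a b} → a ∈ xs → b ∈ xs → f a ≡ f b → a ≡ b
unique-map⇒injectiveOn f (_   ∷ _) (here refl) (here refl) _   = refl
unique-map⇒injectiveOn f (f∉ ∷ _) (here refl) (there b∈) fa≡fb =
  ⊥-elim (All.lookup f∉ (∈-map⁺ f b∈) fa≡fb)
unique-map⇒injectiveOn f (f∉ ∷ _) (there a∈) (here refl) fa≡fb =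
  ⊥-elim (All.lookup f∉ (∈-map⁺ f a∈) (sym fa≡fb))
unique-map⇒injectiveOn f (_  ∷ u) (there a∈) (there b∈) fa≡fb = unique-map⇒injectiveOn f u a∈ b∈ fa≡fb

unique-map⁺ : ∀ {A B : Set} (f : A → B) {xs} → (∀ {a b} → a ∈ xs → b ∈ xs → f a ≡ f b → a ≡ b) →
              Unique xs → Unique (map f xs)
unique-map⁺ f inj [] = []
unique-map⁺ f {x ∷ xs} inj (x∉ ∷ u) =
  All.tabulate fx∉ ∷ unique-map⁺ f (λ a∈ b∈ → inj (there a∈) (there b∈)) u
  where
  fx∉ : ∀ {w} → w ∈ map f xs → f x ≢ w
  fx∉ w∈ fx≡w with ∈-map⁻ f w∈
  ... | b , b∈ , refl = All.lookup x∉ b∈ (inj (here refl) (there b∈) fx≡w)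

Unique-resp-↭ : ∀ {xs ys : List ℕ} → xs ↭ ys → Unique xs → Unique ys
Unique-resp-↭ p = Permutationₛ.Unique-resp-↭ (setoid ℕ) (↭⇒↭ₛ p)

countᵇ : ∀ {A : Set} → (A → Bool) → List A → ℕ
countᵇ f xs = length (filterᵇ f xs)

countᵇ-++ : ∀ {A : Set} (f : A → Bool) xs ys → countᵇ f (xs ++ ys) ≡ countᵇ f xs + countᵇ f ys
countᵇ-++ f xs ys = trans (cong length (filter-++ (T? ∘ f) xs ys)) (length-++ (filterᵇ f xs))

countᵇ-none : ∀ {A : Set} (f : A → Bool) {xs} → (∀ {k} → k ∈ xs → ¬ T (f k)) → countᵇ f xs ≡ 0
countᵇ-none f none = cong length (filter-none (T? ∘ f) (All.tabulate none))

countᵇ-accept : ∀ {A : Set} (f : A → Bool) {x} xs → T (f x) → countᵇ f (x ∷ xs) ≡ suc (countᵇ f xs)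
countᵇ-accept f xs fx = cong length (filter-accept (T? ∘ f) fx)

countᵇ≤length : ∀ {A : Set} (f : A → Bool) xs → countᵇ f xs ≤ length xs
countᵇ≤length f = length-filter (T? ∘ f)

Adj-sym : ∀ {n} (E : BipGraph n) {u w} → Adj E u w → Adj E w u
Adj-sym E {inj₁ _} {inj₂ _} e = e
Adj-sym E {inj₂ _} {inj₁ _} e = e

inS : ∀ {n} → (Fin n → Bool) → Vtx n → Bool
inS S (inj₁ a) = S a
inS S (inj₂ _) = false

inS⇒inj₁ : ∀ {n} {S : Fin n → Bool} w → T (inS S w) → ∃ λ a → w ≡ inj₁ a × T (S a)
inS⇒inj₁ (inj₁ a) Sa = a , refl , Sa

NoCycleThroughTwoS : ∀ {n} → BipGraph n → (Fin n → Bool) → List (Vtx n) → Set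
NoCycleThroughTwoS {n} E S L =
  ¬ (∃ λ (C : List (Vtx n)) → IsCycle E C × All (_∈ L) C
       × ∃₂ λ a b → a ≢ b × T (S a) × T (S b) × inj₁ a ∈ C × inj₁ b ∈ C)

NoShorterEvenPathThroughS : ∀ {n} → BipGraph n → (Fin n → Bool) → List (Vtx n) → Set
NoShorterEvenPathThroughS {n} E S L =
  ¬ (∃ λ (P′ : List (Vtx n)) → IsPath E P′ × All (_∈ L) P′
       × (∃ λ k → length P′ ≡ 2 * k)
       × length P′ < length L
       × (∀ a → T (S a) → (inj₁ a ∈ P′ ⇔ inj₁ a ∈ L)))

m+2h≡2k⇒m≡2[k∸h] : ∀ m h k → m + 2 * h ≡ 2 * k → m ≡ 2 * (k ∸ h)
m+2h≡2k⇒m≡2[k∸h] m h k eq = begin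
  m                 ≡⟨ sym (m+n∸n≡m m (2 * h)) ⟩
  m + 2 * h ∸ 2 * h ≡⟨ cong (_∸ 2 * h) eq ⟩
  2 * k ∸ 2 * h     ≡⟨ sym (*-distribˡ-∸ 2 k h) ⟩
  2 * (k ∸ h)       ∎
  where open ≡-Reasoning

module Chords {n} (E : BipGraph n) (S : Fin n → Bool) (v : ℕ → Vtx n) (K : ℕ)
  (path      : IsPath E (map v (range 0 (2 * K))))
  (noCycle   : NoCycleThroughTwoS E S (map v (range 0 (2 * K))))
  (noShorter : NoShorterEvenPathThroughS E S (map v (range 0 (2 * K))))
  where

  private
    N : ℕ
    N = 2 * K

    L : List (Vtx n)
    L = map v (range 0 N)

  R : ℕ → ℕ → Set
  R = Adj E on v

  SAt : ℕ → Set
  SAt k = T (inS S (v k))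

  v-injective : ∀ {j k} → j < N → k < N → v j ≡ v k → j ≡ k
  v-injective j<N k<N = unique-map⇒injectiveOn v (proj₁ path) (∈-range⁺ z≤n j<N) (∈-range⁺ z≤n k<N)

  step : ∀ {k} → suc k < N → R k (suc k)
  step = Linked-range⇒step 0 N (Linked.map⁻ (proj₂ path)) z≤n

  segment⁺ : ∀ a l {ms} → a + l < N → Linked R (a + l ∷ ms) → Linked R (range a (suc l) ++ ms)
  segment⁺ a l a+l<N = range-linked⁺ a l (λ k<a+l → step (≤-<-trans k<a+l a+l<N))

  segment : ∀ a l → a + l < N → Linked R (range a (suc l))
  segment a l a+l<N = subst (Linked R) (++-identityʳ (range a (suc l))) (segment⁺ a l a+l<N [-])

  inPath : ∀ {ks} → (∀ {k} → k ∈ ks → k < N) → All (_∈ L) (map v ks)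
  inPath bounded = All-map⁺ (All.tabulate (λ k∈ → ∈-map⁺ v (∈-range⁺ z≤n (bounded k∈))))

  unique-positions : ∀ {ks} → (∀ {k} → k ∈ ks → k < N) → Unique ks → Unique (map v ks)
  unique-positions bounded = unique-map⁺ v (λ j∈ k∈ → v-injective (bounded j∈) (bounded k∈))

  two-S-on-chorded-segment⇒⊥ : ∀ {a b c d} → a + 2 ≤ b → b < N → R a b →
                               a ≤ c → c < d → d ≤ b → SAt c → SAt d → ⊥
  two-S-on-chorded-segment⇒⊥ {a} {b} {c} {d} a+2≤b b<N chord a≤c c<d d≤b Sc Sd
    with m≤n⇒∃[o]m+o≡n (≤-trans (m≤m+n a 2) a+2≤b)
  ... | l , refl with inS⇒inj₁ (v c) Sc | inS⇒inj₁ (v d) Sd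
  ...   | s , vc≡s , Ss | t , vd≡t , St =
    noCycle ( C , isCycle , inPath bounded , s , t , s≢t , Ss , St
            , on-cycle c vc≡s a≤c (≤-trans (<⇒≤ c<d) d≤b) , on-cycle d vd≡t (≤-trans a≤c (<⇒≤ c<d)) d≤b)
    where
    ks = range a (suc l)
    C  = map v ks

    bounded : ∀ {k} → k ∈ ks → k < N
    bounded {k} k∈ = ≤-<-trans (≤-pred (subst (k <_) (+-suc a l) (proj₂ (∈-range⁻ k∈)))) b<N

    isCycle : IsCycle E C
    isCycle = unique-positions bounded (Unique-range a (suc l))
            , subst (3 ≤_) (sym (trans (length-map v ks) (length-range a (suc l))))
                    (s≤s (+-cancelˡ-≤ a 2 l a+2≤b))
            , subst (Linked (Adj E)) (map-++ v ks [ a ])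
                    (Linked.map⁺ (segment⁺ a l {[ a ]} b<N (Adj-sym E {v a} {v (a + l)} chord ∷ [-])))

    on-cycle : ∀ k {w} → v k ≡ inj₁ w → a ≤ k → k ≤ a + l → inj₁ w ∈ C
    on-cycle k vk≡w a≤k k≤a+l =
      subst (_∈ C) vk≡w (∈-map⁺ v (∈-range⁺ a≤k (subst (k <_) (sym (+-suc a l)) (s≤s k≤a+l))))

    s≢t : s ≢ t
    s≢t refl = <⇒≢ c<d (v-injective (≤-<-trans (≤-trans (<⇒≤ c<d) d≤b) b<N) (≤-<-trans d≤b b<N)
                                    (trans vc≡s (sym vd≡t)))

  S-covering-path⇒⊥ : ∀ ks → Unique ks → (∀ {k} → k ∈ ks → k < N) → Linked R ks →
                      (∃ λ m → length ks ≡ 2 * m) → length ks < N → (∀ {k} → k < N → SAt k → k ∈ ks) → ⊥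
  S-covering-path⇒⊥ ks unique bounded linked (m , even) shorter covers =
    noShorter ( map v ks
              , (unique-positions bounded unique , Linked.map⁺ linked)
              , inPath bounded
              , (m , trans (length-map v ks) even)
              , subst₂ _<_ (sym (length-map v ks)) (sym (trans (length-map v (range 0 N)) (length-range 0 N))) shorter
              , λ a Sa → mk⇔ (All.lookup (inPath bounded)) (back Sa))
    where
    back : ∀ {a} → T (S a) → inj₁ a ∈ L → inj₁ a ∈ map v ks
    back Sa a∈L with ∈-map⁻ v a∈L
    ... | k , k∈ , a≡vk =
      subst (_∈ map v ks) (sym a≡vk) (∈-map⁺ v (covers (proj₂ (∈-range⁻ k∈)) (subst (T ∘ inS S) a≡vk Sa)))

  -- The path is rerouted around the gap (a, a + 2h + 2], keeping its first a + 1 vertices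
  -- and visiting the last r in some order ts.
  rerouted-path⇒⊥ : ∀ a h r {ts} → suc a + 2 * suc h + r ≡ N → ts ↭ range (suc a + 2 * suc h) r →
                    Linked R (a ∷ ts) → (∀ {k} → k ∈ range (suc a) (2 * suc h) → ¬ SAt k) → ⊥
  rerouted-path⇒⊥ a h r {ts} total perm linked S-free =
    S-covering-path⇒⊥ ks unique bounded (segment⁺ 0 a (<-≤-trans a<b b≤N) linked)
      (K ∸ suc h , trans len even) (subst (_< N) (sym len) shorter) covers
    where
    g  = 2 * suc h
    b  = suc a + g
    ks = range 0 (suc a) ++ ts

    a<b : a < b
    a<b = m≤m+n (suc a) g

    b≤N : b ≤ N
    b≤N = subst (b ≤_) total (m≤m+n b r)

    in-tail : ∀ {k} → k ∈ ts → b ≤ k × k < b + r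
    in-tail k∈ = ∈-range⁻ (∈-resp-↭ perm k∈)

    len : length ks ≡ suc a + r
    len = trans (length-++ (range 0 (suc a)))
                (cong₂ _+_ (length-range 0 (suc a)) (trans (↭-length perm) (length-range b r)))

    even : suc a + r ≡ 2 * (K ∸ suc h)
    even = m+2h≡2k⇒m≡2[k∸h] (suc a + r) (suc h) K (trans (swap (suc a) r g) total)
      where swap : ∀ x y z → x + y + z ≡ x + z + y
            swap = solve-∀

    shorter : suc a + r < N
    shorter = subst (suc a + r <_) total (+-monoˡ-< r (m<m+n (suc a) z<s))

    unique : Unique ks
    unique = ++⁺ (Unique-range 0 (suc a)) (Unique-resp-↭ (↭-sym perm) (Unique-range b r))
                 (λ (k∈ , k∈ts) → <⇒≱ (proj₂ (∈-range⁻ k∈)) (≤-trans a<b (proj₁ (in-tail k∈ts))))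

    bounded : ∀ {k} → k ∈ ks → k < N
    bounded {k} k∈ with ∈-++⁻ (range 0 (suc a)) k∈
    ... | inj₁ k∈ʰ = <-≤-trans (proj₂ (∈-range⁻ k∈ʰ)) (≤-trans a<b b≤N)
    ... | inj₂ k∈ᵗ = subst (k <_) total (proj₂ (in-tail k∈ᵗ))

    split : range 0 N ≡ (range 0 (suc a) ++ range (suc a) g) ++ range b r
    split = begin
      range 0 N                                      ≡⟨ cong (range 0) (sym total) ⟩
      range 0 (b + r)                                ≡⟨ range-++ 0 b r ⟩
      range 0 b ++ range b r                         ≡⟨ cong (_++ range b r) (range-++ 0 (suc a) g) ⟩
      (range 0 (suc a) ++ range (suc a) g) ++ range b r ∎
      where open ≡-Reasoning

    covers : ∀ {k} → k < N → SAt k → k ∈ ks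
    covers {k} k<N Sk with ∈-++⁻ (range 0 (suc a) ++ range (suc a) g) (subst (k ∈_) split (∈-range⁺ z≤n k<N))
    ... | inj₂ k∈ᵗ = ∈-++⁺ʳ (range 0 (suc a)) (∈-resp-↭ (↭-sym perm) k∈ᵗ)
    ... | inj₁ k∈ with ∈-++⁻ (range 0 (suc a)) k∈
    ...   | inj₁ k∈ʰ   = ∈-++⁺ˡ k∈ʰ
    ...   | inj₂ k∈gap = ⊥-elim (S-free k∈gap Sk)

  S-inside? : ∀ a g → (∃ λ k → k ∈ range (suc a) g × SAt k) ⊎ (∀ {k} → k ∈ range (suc a) g → ¬ SAt k)
  S-inside? a g with any? (λ k → T? (inS S (v k))) (range (suc a) g)
  ... | yes some = inj₁ (find some)
  ... | no  none = inj₂ (λ k∈ Sk → none (lose k∈ Sk))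

  S-end-chord⇒⊥ : ∀ a h r → suc a + 2 * suc h + suc r ≡ N → R a (suc a + 2 * suc h) →
                  SAt a ⊎ SAt (suc a + 2 * suc h) → ⊥
  S-end-chord⇒⊥ a h r total chord S-end = case S-inside? a (2 * suc h) of λ where
      (inj₁ (k , k∈ , Sk)) → two-S (∈-range⁻ k∈) Sk S-end
      (inj₂ S-free)        → rerouted-path⇒⊥ a h (suc r) total ↭-refl (chord ∷ segment b r b+r<N) S-free
    where
    b = suc a + 2 * suc h

    b<N : b < N
    b<N = subst (b <_) total (m<m+n b z<s)

    b+r<N : b + r < N
    b+r<N = subst (b + r <_) total (≤-reflexive (sym (+-suc b r)))

    a+2≤b : a + 2 ≤ b
    a+2≤b = subst (a + 2 ≤_) (gap a h) (m≤m+n (a + 2) (suc (2 * h)))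
      where gap : ∀ a h → a + 2 + suc (2 * h) ≡ suc a + 2 * suc h
            gap = solve-∀

    two-S : ∀ {k} → suc a ≤ k × k < b → SAt k → SAt a ⊎ SAt b → ⊥
    two-S (a<k , k<b) Sk (inj₁ Sa) = two-S-on-chorded-segment⇒⊥ a+2≤b b<N chord ≤-refl a<k (<⇒≤ k<b) Sa Sk
    two-S (a<k , k<b) Sk (inj₂ Sb) = two-S-on-chorded-segment⇒⊥ a+2≤b b<N chord (<⇒≤ a<k) k<b ≤-refl Sk Sb

  S-next-to-end-chord⇒⊥ : ∀ a h → suc a + 2 * suc h + 3 ≡ N → R a (2 + (suc a + 2 * suc h)) →
                          SAt (suc (suc a + 2 * suc h)) → ⊥
  S-next-to-end-chord⇒⊥ a h total chord S-next = case S-inside? a (2 * suc h) of λ where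
      (inj₁ (k , k∈ , Sk)) → two-S (∈-range⁻ k∈) Sk
      (inj₂ S-free)        → rerouted-path⇒⊥ a h 3 total (↭-reverse (range c 3))
                               (chord ∷ back (suc c) end<N ∷ back c (<-trans (n<1+n (suc c)) end<N) ∷ [-]) S-free
    where
    c = suc a + 2 * suc h

    end<N : 2 + c < N
    end<N = subst (2 + c <_) (trans (+-comm 3 c) total) ≤-refl

    back : ∀ k → suc k < N → R (suc k) k
    back k sk<N = Adj-sym E {v k} {v (suc k)} (step sk<N)

    two-S : ∀ {k} → suc a ≤ k × k < c → SAt k → ⊥
    two-S (a<k , k<c) Sk =
      two-S-on-chorded-segment⇒⊥ a+2≤end end<N chord (<⇒≤ a<k) (<-trans k<c (n<1+n c)) (n≤1+n _) Sk S-next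
      where
      a+2≤end : a + 2 ≤ 2 + c
      a+2≤end = subst (_≤ 2 + c) (+-comm 2 a) (s≤s (s≤s (≤-trans (n≤1+n a) (m≤m+n (suc a) _))))

vertexAt : ∀ {n} → (ℕ → Fin n) → (ℕ → Fin n) → ℕ → Vtx n
vertexAt X Y zero          = inj₁ (X 0)
vertexAt X Y (suc zero)    = inj₂ (Y 0)
vertexAt X Y (suc (suc k)) = vertexAt (X ∘ suc) (Y ∘ suc) k

vertexAt-even : ∀ {n} (X Y : ℕ → Fin n) m → vertexAt X Y (2 * m) ≡ inj₁ (X m)
vertexAt-even X Y zero    = refl
vertexAt-even X Y (suc m) =
  subst (λ k → vertexAt X Y k ≡ inj₁ (X (suc m))) (sym (*-suc 2 m)) (vertexAt-even (X ∘ suc) (Y ∘ suc) m)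

vertexAt-odd : ∀ {n} (X Y : ℕ → Fin n) m → vertexAt X Y (suc (2 * m)) ≡ inj₂ (Y m)
vertexAt-odd X Y zero    = refl
vertexAt-odd X Y (suc m) =
  subst (λ k → vertexAt X Y (suc k) ≡ inj₂ (Y (suc m))) (sym (*-suc 2 m)) (vertexAt-odd (X ∘ suc) (Y ∘ suc) m)

block : ∀ {n} → (ℕ → Fin n) → (ℕ → Fin n) → ℕ → List (Vtx n)
block X Y m = inj₁ (X m) ∷ inj₂ (Y m) ∷ []

blocks≡positions : ∀ {n} (X Y : ℕ → Fin n) p →
                   concatMap (block X Y) (range 0 p) ≡ map (vertexAt X Y) (range 0 (2 * p))
blocks≡positions X Y zero    = refl
blocks≡positions X Y (suc p) = begin
  inj₁ (X 0) ∷ inj₂ (Y 0) ∷ concatMap (block X Y) (range 1 p)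
    ≡⟨ cong (λ rest → inj₁ (X 0) ∷ inj₂ (Y 0) ∷ rest) tail-blocks ⟩
  map (vertexAt X Y) (range 0 (2 + 2 * p))
    ≡⟨ cong (map (vertexAt X Y) ∘ range 0) (sym (*-suc 2 p)) ⟩
  map (vertexAt X Y) (range 0 (2 * suc p)) ∎
  where
  open ≡-Reasoning
  X′ = X ∘ suc
  Y′ = Y ∘ suc

  tail-blocks : concatMap (block X Y) (range 1 p) ≡ map (vertexAt X Y) (range 2 (2 * p))
  tail-blocks = begin
    concat (map (block X Y) (range 1 p))        ≡⟨ cong concat (map-range-suc (block X Y) 0 p) ⟩
    concatMap (block X′ Y′) (range 0 p)         ≡⟨ blocks≡positions X′ Y′ p ⟩
    map (vertexAt X′ Y′) (range 0 (2 * p))      ≡⟨ sym (map-range-suc (vertexAt X Y ∘ suc) 0 (2 * p)) ⟩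
    map (vertexAt X Y ∘ suc) (range 1 (2 * p))  ≡⟨ sym (map-range-suc (vertexAt X Y) 1 (2 * p)) ⟩
    map (vertexAt X Y) (range 2 (2 * p))        ∎

deg-inj₁-blocks : ∀ {n} (E : BipGraph n) (X Y : ℕ → Fin n) a ks →
                  deg E (inj₁ a) (concatMap (block X Y) ks) ≡ countᵇ (λ m → E a (Y m)) ks
deg-inj₁-blocks E X Y a []       = refl
deg-inj₁-blocks E X Y a (k ∷ ks) with E a (Y k)
... | true  = cong suc (deg-inj₁-blocks E X Y a ks)
... | false = deg-inj₁-blocks E X Y a ks

deg-inj₂-blocks : ∀ {n} (E : BipGraph n) (X Y : ℕ → Fin n) b ks →
                  deg E (inj₂ b) (concatMap (block X Y) ks) ≡ countᵇ (λ m → E (X m) b) ks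
deg-inj₂-blocks E X Y b []       = refl
deg-inj₂-blocks E X Y b (k ∷ ks) with E (X k) b
... | true  = cong suc (deg-inj₂-blocks E X Y b ks)
... | false = deg-inj₂-blocks E X Y b ks

countᵇ-last-two : ∀ (f : ℕ → Bool) l → (∀ {k} → k ∈ range 0 l → T (f k) → l ≤ 2 + k) → countᵇ f (range 0 l) ≤ 2
countᵇ-last-two f zero          _         = z≤n
countᵇ-last-two f (suc zero)    _         = ≤-trans (countᵇ≤length f (range 0 1)) (s≤s z≤n)
countᵇ-last-two f (suc (suc l)) last-only = begin
  countᵇ f (range 0 (2 + l))                 ≡⟨ cong (countᵇ f) (trans (cong (range 0) (+-comm 2 l)) (range-++ 0 l 2)) ⟩
  countᵇ f (range 0 l ++ range l 2)          ≡⟨ countᵇ-++ f (range 0 l) (range l 2) ⟩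
  countᵇ f (range 0 l) + countᵇ f (range l 2) ≡⟨ cong (_+ countᵇ f (range l 2)) (countᵇ-none f early) ⟩
  countᵇ f (range l 2)                       ≤⟨ countᵇ≤length f (range l 2) ⟩
  2                                          ∎
  where
  open ≤-Reasoning
  early : ∀ {k} → k ∈ range 0 l → ¬ T (f k)
  early k∈ fk = <⇒≱ k<l (+-cancelˡ-≤ 2 l _ (last-only (∈-range⁺ z≤n (≤-trans k<l (m≤n+m l 2))) fk))
    where k<l = proj₂ (∈-range⁻ k∈)

-- Saturates at q; only its values on 0 … q are ever used.
clamp : ∀ {q} → ℕ → Fin (suc q)
clamp         zero    = zero
clamp {zero}  (suc m) = zero
clamp {suc q} (suc m) = suc (clamp m)

clamp-toℕ : ∀ {q} (i : Fin (suc q)) → clamp (toℕ i) ≡ i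
clamp-toℕ         zero    = refl
clamp-toℕ {suc q} (suc i) = cong suc (clamp-toℕ i)

tabulate-toℕ : ∀ {A : Set} l (f : ℕ → A) → tabulate {n = l} (f ∘ toℕ) ≡ map f (range 0 l)
tabulate-toℕ zero    f = refl
tabulate-toℕ (suc l) f = cong (f 0 ∷_) (trans (tabulate-toℕ l (f ∘ suc)) (sym (map-range-suc f 0 l)))

alternating≡blocks : ∀ {n q} (x y : Fin (suc q) → Fin n) →
                     alternating x y ≡ concatMap (block (x ∘ clamp) (y ∘ clamp)) (range 0 (suc q))
alternating≡blocks {q = q} x y = cong concat (begin
  map (λ i → inj₁ (x i) ∷ inj₂ (y i) ∷ []) (tabulate (λ i → i))
    ≡⟨ map-tabulate (λ i → i) _ ⟩
  tabulate (λ i → inj₁ (x i) ∷ inj₂ (y i) ∷ [])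
    ≡⟨ tabulate-cong (λ i → cong (λ j → inj₁ (x j) ∷ inj₂ (y j) ∷ []) (sym (clamp-toℕ i))) ⟩
  tabulate (block (x ∘ clamp) (y ∘ clamp) ∘ toℕ)
    ≡⟨ tabulate-toℕ (suc q) _ ⟩
  map (block (x ∘ clamp) (y ∘ clamp)) (range 0 (suc q)) ∎)
  where open ≡-Reasoning

clamp-fromℕ : ∀ q → clamp q ≡ fromℕ q
clamp-fromℕ q = trans (cong clamp (sym (toℕ-fromℕ q))) (clamp-toℕ (fromℕ q))

deg-x-alternating : ∀ {n q} (E : BipGraph n) (x y : Fin (suc q) → Fin n) i →
                    deg E (inj₁ (x i)) (alternating x y)
                      ≡ countᵇ (λ m → E (x (clamp (toℕ i))) (y (clamp m))) (range 0 (suc q))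
deg-x-alternating {q = q} E x y i =
  trans (cong₂ (deg E ∘ inj₁) (cong x (sym (clamp-toℕ i))) (alternating≡blocks x y))
        (deg-inj₁-blocks E (x ∘ clamp) (y ∘ clamp) (x (clamp (toℕ i))) (range 0 (suc q)))

deg-y-alternating : ∀ {n q} (E : BipGraph n) (x y : Fin (suc q) → Fin n) →
                    deg E (inj₂ (y (fromℕ q))) (alternating x y)
                      ≡ countᵇ (λ m → E (x (clamp m)) (y (clamp q))) (range 0 (suc q))
deg-y-alternating {q = q} E x y =
  trans (cong₂ (deg E ∘ inj₂) (cong y (sym (clamp-fromℕ q))) (alternating≡blocks x y))
        (deg-inj₂-blocks E (x ∘ clamp) (y ∘ clamp) (y (clamp q)) (range 0 (suc q)))

module AlternatingPath {n} (E : BipGraph n) (S : Fin n → Bool) (X Y : ℕ → Fin n) (q : ℕ)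
  (path      : IsPath E (map (vertexAt X Y) (range 0 (2 * suc q))))
  (noCycle   : NoCycleThroughTwoS E S (map (vertexAt X Y) (range 0 (2 * suc q))))
  (noShorter : NoShorterEvenPathThroughS E S (map (vertexAt X Y) (range 0 (2 * suc q))))
  where

  open Chords E S (vertexAt X Y) (suc q) path noCycle noShorter

  private
    x-at : ∀ m → vertexAt X Y (2 * m) ≡ inj₁ (X m)
    x-at = vertexAt-even X Y

    y-at : ∀ m → vertexAt X Y (suc (2 * m)) ≡ inj₂ (Y m)
    y-at = vertexAt-odd X Y

    S-at-even : ∀ {m k} → k ≡ 2 * m → T (S (X m)) → SAt k
    S-at-even {m} refl Sm = subst (T ∘ inS S) (sym (x-at m)) Sm

  1+2m<2[1+q] : ∀ {m} → m ≤ q → suc (2 * m) < 2 * suc q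
  1+2m<2[1+q] {m} m≤q = subst (_≤ 2 * suc q) (*-suc 2 m) (*-monoʳ-≤ 2 (s≤s m≤q))

  x-y-edge : ∀ {m} → m ≤ q → T (E (X m) (Y m))
  x-y-edge {m} m≤q = subst₂ (Adj E) (x-at m) (y-at m) (step (1+2m<2[1+q] m≤q))

  y-x-edge : ∀ {m} → suc m ≤ q → T (E (X (suc m)) (Y m))
  y-x-edge {m} m<q =
    subst₂ (Adj E) (y-at m) (trans (cong (vertexAt X Y) (sym (*-suc 2 m))) (x-at (suc m)))
      (step (subst (_< 2 * suc q) (*-suc 2 m) (<-trans (n<1+n _) (1+2m<2[1+q] m<q))))

  no-forward-chord : ∀ {i m} → suc i ≤ m → m ≤ q → T (S (X i)) → ¬ T (E (X i) (Y m))
  no-forward-chord {i} i<m m≤q Si e with m≤n⇒∃[o]m+o≡n i<m | m≤n⇒∃[o]m+o≡n m≤q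
  ... | h , refl | d , m+d≡q =
    S-end-chord⇒⊥ (2 * i) h (2 * d) (trans (total i h d) (cong (λ z → 2 * suc z) m+d≡q))
      (subst₂ (Adj E) (sym (x-at i)) (sym (trans (cong (vertexAt X Y) (end i h)) (y-at (suc i + h)))) e)
      (inj₁ (S-at-even refl Si))
    where
    total : ∀ i h d → suc (2 * i) + 2 * suc h + suc (2 * d) ≡ 2 * suc (suc i + h + d)
    total = solve-∀
    end : ∀ i h → suc (2 * i) + 2 * suc h ≡ suc (2 * (suc i + h))
    end = solve-∀

  no-backward-chord : ∀ {i m} → suc (suc m) ≤ i → i ≤ q → T (S (X i)) → ¬ T (E (X i) (Y m))
  no-backward-chord {i} {m} m+1<i i≤q Si e with m≤n⇒∃[o]m+o≡n m+1<i | m≤n⇒∃[o]m+o≡n i≤q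
  ... | h , refl | d , i+d≡q =
    S-end-chord⇒⊥ (suc (2 * m)) h (suc (2 * d)) (trans (total m h d) (cong (λ z → 2 * suc z) i+d≡q))
      (subst₂ (Adj E) (sym (y-at m)) (sym (trans (cong (vertexAt X Y) (end m h)) (x-at (suc (suc m) + h)))) e)
      (inj₂ (S-at-even (end m h) Si))
    where
    total : ∀ m h d → suc (suc (2 * m)) + 2 * suc h + suc (suc (2 * d)) ≡ 2 * suc (suc (suc m) + h + d)
    total = solve-∀
    end : ∀ m h → suc (suc (2 * m)) + 2 * suc h ≡ 2 * (suc (suc m) + h)
    end = solve-∀

  S-x-neighbour : ∀ {i m} → i ≤ q → m ≤ q → T (S (X i)) → T (E (X i) (Y m)) → m ≤ i × i ≤ suc m
  S-x-neighbour {i} {m} i≤q m≤q Si e with suc i ≤? m | suc (suc m) ≤? i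
  ... | yes i<m | _         = ⊥-elim (no-forward-chord i<m m≤q Si e)
  ... | no  _   | yes m+1<i = ⊥-elim (no-backward-chord m+1<i i≤q Si e)
  ... | no  i≮m | no  m+1≮i = ≤-pred (≰⇒> i≮m) , ≤-pred (≰⇒> m+1≮i)

  S-last-neighbour : ∀ {j} → T (S (X q)) → T (E (X j) (Y q)) → q ≤ suc j
  S-last-neighbour {j} Sq e with suc (suc j) ≤? q
  ... | no  j+1≮q = ≤-pred (≰⇒> j+1≮q)
  ... | yes j+1<q with m≤n⇒∃[o]m+o≡n j+1<q
  ...   | h , j+2+h≡q = ⊥-elim (S-next-to-end-chord⇒⊥ (2 * j) h
          (trans (total j h) (cong (λ z → 2 * suc z) j+2+h≡q))
          (subst₂ (Adj E) (sym (x-at j)) (sym (trans (cong (vertexAt X Y) end) (y-at q))) e)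
          (S-at-even (trans (next j h) (cong (2 *_) j+2+h≡q)) Sq))
    where
    total : ∀ j h → suc (2 * j) + 2 * suc h + 3 ≡ 2 * suc (suc (suc j) + h)
    total = solve-∀
    next : ∀ j h → suc (suc (2 * j) + 2 * suc h) ≡ 2 * (suc (suc j) + h)
    next = solve-∀
    end : 2 + (suc (2 * j) + 2 * suc h) ≡ suc (2 * q)
    end = trans (identity j h) (cong (λ z → suc (2 * z)) j+2+h≡q)
      where identity : ∀ j h → 2 + (suc (2 * j) + 2 * suc h) ≡ suc (2 * (suc (suc j) + h))
            identity = solve-∀

  countᵇ-first : T (S (X 0)) → countᵇ (λ m → E (X 0) (Y m)) (range 0 (suc q)) ≡ 1
  countᵇ-first S₀ = trans (countᵇ-accept _ (range 1 q) (x-y-edge z≤n)) (cong suc (countᵇ-none _ no-chord))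
    where
    no-chord : ∀ {m} → m ∈ range 1 q → ¬ T (E (X 0) (Y m))
    no-chord m∈ e with ∈-range⁻ m∈
    ... | 0<m , m<1+q = <⇒≱ 0<m (proj₁ (S-x-neighbour z≤n (≤-pred m<1+q) S₀ e))

  countᵇ-inner : ∀ t → suc t ≤ q → T (S (X (suc t))) → countᵇ (λ m → E (X (suc t)) (Y m)) (range 0 (suc q)) ≡ 2
  countᵇ-inner t t<q St with m≤n⇒∃[o]m+o≡n t<q
  ... | e , t+1+e≡q = begin
    countᵇ f (range 0 (suc q))                                  ≡⟨ cong (countᵇ f) around ⟩
    countᵇ f (range 0 t ++ t ∷ suc t ∷ range (2 + t) e)         ≡⟨ countᵇ-++ f (range 0 t) _ ⟩
    countᵇ f (range 0 t) + countᵇ f (t ∷ suc t ∷ range (2 + t) e)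
      ≡⟨ cong₂ _+_ (countᵇ-none f before) (countᵇ-accept f _ (y-x-edge t<q)) ⟩
    suc (countᵇ f (suc t ∷ range (2 + t) e))                    ≡⟨ cong suc (countᵇ-accept f _ (x-y-edge t<q)) ⟩
    2 + countᵇ f (range (2 + t) e)                              ≡⟨ cong (2 +_) (countᵇ-none f after) ⟩
    2                                                           ∎
    where
    open ≡-Reasoning
    f = λ m → E (X (suc t)) (Y m)

    around : range 0 (suc q) ≡ range 0 t ++ range t (2 + e)
    around = trans (cong (range 0) (trans (cong suc (sym t+1+e≡q)) (shift t e))) (range-++ 0 t (2 + e))
      where shift : ∀ t e → suc (suc t + e) ≡ t + (2 + e)
            shift = solve-∀

    neighbour : ∀ {m} → m < 2 + t + e → T (f m) → m ≤ suc t × t ≤ m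
    neighbour {m} m<end fm =
      let m≤i , i≤m+1 = S-x-neighbour t<q (≤-trans (≤-pred m<end) (≤-reflexive t+1+e≡q)) St fm
      in m≤i , ≤-pred i≤m+1

    before : ∀ {m} → m ∈ range 0 t → ¬ T (f m)
    before m∈ fm = let m<t = proj₂ (∈-range⁻ m∈) in
      <⇒≱ m<t (proj₂ (neighbour (≤-trans m<t (≤-trans (m≤n+m t 2) (m≤m+n (2 + t) e))) fm))

    after : ∀ {m} → m ∈ range (2 + t) e → ¬ T (f m)
    after m∈ fm = let t+2≤m , m<end = ∈-range⁻ m∈ in <⇒≱ t+2≤m (proj₁ (neighbour m<end fm))

  countᵇ-last : T (S (X q)) → countᵇ (λ m → E (X m) (Y q)) (range 0 (suc q)) ≤ 2
  countᵇ-last Sq = countᵇ-last-two _ (suc q) (λ _ e → s≤s (S-last-neighbour Sq e))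

lemma5 : (n : ℕ) (E : BipGraph n) (S : Fin n → Bool) (q : ℕ)
    (x y : Fin (suc q) → Fin n)
    → q ≢ 0
    → IsPath E (alternating x y)
    → T (S (x zero))
    → T (S (x (fromℕ q)))
    → ¬ (∃ λ (C : List (Vtx n)) → IsCycle E C × All (_∈ alternating x y) C
           × ∃₂ λ a b → a ≢ b × T (S a) × T (S b) × inj₁ a ∈ C × inj₁ b ∈ C)
    → ¬ (∃ λ (P′ : List (Vtx n)) → IsPath E P′ × All (_∈ alternating x y) P′
           × (∃ λ k → length P′ ≡ 2 * k)
           × length P′ < length (alternating x y)
           × (∀ a → T (S a) → (inj₁ a ∈ P′ ⇔ inj₁ a ∈ alternating x y)))
    → deg E (inj₁ (x zero)) (alternating x y) ≡ 1
      × (∀ i → T (S (x i)) → x i ≢ x zero → deg E (inj₁ (x i)) (alternating x y) ≡ 2)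
      × deg E (inj₂ (y (fromℕ q))) (alternating x y) ≤ 2
lemma5 n E S q x y _ path S₀ S-last noCycle noShorter =
    trans (deg-x-alternating E x y zero) (countᵇ-first S₀)
  , deg-inner
  , subst (_≤ 2) (sym (deg-y-alternating E x y)) (countᵇ-last (subst (T ∘ S ∘ x) (sym (clamp-fromℕ q)) S-last))
  where
  X = x ∘ clamp
  Y = y ∘ clamp

  positions : alternating x y ≡ map (vertexAt X Y) (range 0 (2 * suc q))
  positions = trans (alternating≡blocks x y) (blocks≡positions X Y (suc q))

  open AlternatingPath E S X Y q (subst (IsPath E) positions path)
    (subst (NoCycleThroughTwoS E S) positions noCycle) (subst (NoShorterEvenPathThroughS E S) positions noShorter)

  deg-inner : ∀ i → T (S (x i)) → x i ≢ x zero → deg E (inj₁ (x i)) (alternating x y) ≡ 2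
  deg-inner zero    _  xᵢ≢x₀ = ⊥-elim (xᵢ≢x₀ refl)
  deg-inner (suc i) Sᵢ _     =
    trans (deg-x-alternating E x y (suc i))
          (countᵇ-inner (toℕ i) (≤-pred (toℕ<n (suc i))) (subst (T ∘ S ∘ x) (sym (clamp-toℕ (suc i))) Sᵢ))
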